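{- Let $F \subseteq \mathbb{Z}_2^\omega$ be a thin set. Then Ego has no winning strategy in the game $\mathcal{G}(F)$.
   Context: $\omega=\{0,1,2,\dots\}$; $\mathbb{Z}_2^\omega$ is the set of infinite binary sequences and $\mathbb{Z}_2^+ := \bigcup_{n\ge1}\mathbb{Z}_2^n$ the set of nonempty finite binary words. For $n\in\omega$ let $\mathrm{pr}_n(x) := x|_{\omega\setminus\{n\}}$; a set $T\subseteq\mathbb{Z}_2^\omega$ is thin if each $\mathrm{pr}_n|_T$ is injective. For $F\subseteq\mathbb{Z}_2^\omega$, $\mathcal{G}(F)$ is the following infinite two-player game of perfect information between Ego and Alter: the players alternately choose nonempty finite words $\epsilon_0,\alpha_1,\epsilon_1,\alpha_2,\epsilon_2,\dots\in\mathbb{Z}_2^+$ (Ego chooses the $\epsilon_i$, starting with $\epsilon_0$; Alter chooses the $\alpha_i$), each player knowing all previous moves; the outcome is the concatenation $\epsilon_0\alpha_1\epsilon_1\alpha_2\epsilon_2\cdots\in\mathbb{Z}_2^\omega$. Ego wins if the outcome lies in $F$, otherwise Alter wins. A strategy for Ego is a function $e\colon\bigcup_{n\ge0}(\mathbb{Z}_2^+)^n\to\mathbb{Z}_2^+$ (giving Ego's next move from Alter's previous moves), and for Alter a function $a\colon\bigcup_{n\ge1}(\mathbb{Z}_2^+)^n\to\mathbb{Z}_2^+$; a strategy is winning for a player if every play in which that player follows it is won by that player. -}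

module Defs where

open import Data.Bool using (Bool; false)
open import Data.Nat using (ℕ; zero; suc)
open import Data.List using (List; []; _∷_; _++_; [_])
open import Data.List.NonEmpty using (List⁺; toList; _⁺∷ʳ_) renaming ([_] to [_]⁺)
open import Relation.Binary.PropositionalEquality using (_≡_; _≢_)

Seq : Set
Seq = ℕ → Bool

Word : Set
Word = List⁺ Bool

Subset : Set₁
Subset = Seq → Set

-- x and y agree except possibly at coordinate n, i.e. pr_n x = pr_n y
AgreeOff : ℕ → Seq → Seq → Set
AgreeOff n x y = ∀ m → m ≢ n → x m ≡ y m

Thin : Subset → Set
Thin T = ∀ n x y → T x → T y → AgreeOff n x y → ∀ m → x m ≡ y m

-- Strategies.  Histories are listed chronologically.
-- Ego: from Alter's previous moves (α₁,…,αₙ), n ≥ 0, give εₙ.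
EgoStrategy : Set
EgoStrategy = List Word → Word

-- Alter: from Ego's previous moves (ε₀,…,εₙ₋₁), n ≥ 1, give αₙ.
AlterStrategy : Set
AlterStrategy = List⁺ Word → Word

module Play (e : EgoStrategy) (a : AlterStrategy) where
  mutual
    alterHist : ℕ → List Word
    alterHist zero = []
    alterHist (suc n) = alterHist n ++ [ a (egoHist n) ]

    egoHist : ℕ → List⁺ Word
    egoHist zero = [ e [] ]⁺
    egoHist (suc n) = egoHist n ⁺∷ʳ e (alterHist (suc n))

  -- εₙ and αₙ₊₁
  egoMove : ℕ → Word
  egoMove n = e (alterHist n)

  alterMove : ℕ → Word
  alterMove n = a (egoHist n)

interleave : {A : Set} → (ℕ → A) → (ℕ → A) → ℕ → A
interleave s t zero = s 0
interleave s t (suc n) = interleave t (λ k → s (suc k)) n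

-- bit at position k of the infinite concatenation  cur ++ w 0 ++ w 1 ++ …
-- (fuel bounds the number of words to be opened; suc k suffices since words are nonempty)
walk : ℕ → List Bool → (ℕ → Word) → ℕ → Bool
walk fuel (b ∷ bs) w zero = b
walk fuel (b ∷ bs) w (suc k) = walk fuel bs w k
walk zero [] w k = false
walk (suc f) [] w k = walk f (toList (w 0)) (λ i → w (suc i)) k

concatWords : (ℕ → Word) → Seq
concatWords w k = walk (suc k) [] w k

outcome : EgoStrategy → AlterStrategy → Seq
outcome e a = concatWords (interleave egoMove alterMove)
  where open Play e a

EgoWinning : Subset → EgoStrategy → Set
EgoWinning F e = ∀ (a : AlterStrategy) → F (outcome e a)

module Submission where

-- Alter plays two copies of the game against Ego's strategy e at once.  He answers
-- ε₀ with 0 in the first copy and with 1ε₁ in the second, where ε₁ is Ego's reply in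
-- the first copy; from then on each copy's Alter move is Ego's latest move in the
-- other copy.  The outcomes are ε₀ 0 ε₁ ε₁′ ε₂ ε₂′ ⋯ and ε₀ 1 ε₁ ε₁′ ε₂ ε₂′ ⋯, which
-- differ exactly at position |ε₀|, so they cannot both lie in a thin set.

open import Defs
open import Data.Bool using (Bool; true; false)
open import Data.Empty using (⊥; ⊥-elim)
open import Data.List using (List; []; _∷_; _++_; [_]; length)
open import Data.List.NonEmpty using (List⁺; _∷_; toList; _⁺∷ʳ_)
  renaming ([_] to [_]⁺; length to length⁺)
open import Data.List.Properties using (length-++)
open import Data.Nat using (ℕ; zero; suc; _+_; _≤_; _<_; s≤s)
open import Data.Nat.Properties using (≤-refl; ≤-trans; m≤n+m; +-comm)
open import Data.Product using (∃; _,_)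
open import Function using (_∘_)
open import Relation.Nullary using (¬_)
open import Relation.Binary.PropositionalEquality
  using (_≡_; _≢_; _≗_; refl; sym; trans; cong; cong₂; module ≡-Reasoning)

infixr 5 _++ˢ_

_++ˢ_ : {A : Set} → List A → (ℕ → A) → ℕ → A
([] ++ˢ s) k = s k
((x ∷ xs) ++ˢ s) zero = x
((x ∷ xs) ++ˢ s) (suc k) = (xs ++ˢ s) k

++ˢ-assoc : {A : Set} (xs ys : List A) (s : ℕ → A) → (xs ++ ys) ++ˢ s ≗ xs ++ˢ ys ++ˢ s
++ˢ-assoc [] ys s k = refl
++ˢ-assoc (x ∷ xs) ys s zero = refl
++ˢ-assoc (x ∷ xs) ys s (suc k) = ++ˢ-assoc xs ys s k

++ˢ-cong : {A : Set} (xs : List A) {s t : ℕ → A} → s ≗ t → xs ++ˢ s ≗ xs ++ˢ t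
++ˢ-cong [] s≗t k = s≗t k
++ˢ-cong (x ∷ xs) s≗t zero = refl
++ˢ-cong (x ∷ xs) s≗t (suc k) = ++ˢ-cong xs s≗t k

++ˢ-length : {A : Set} (xs : List A) (s : ℕ → A) → (xs ++ˢ s) (length xs) ≡ s 0
++ˢ-length [] s = refl
++ˢ-length (x ∷ xs) s = ++ˢ-length xs s

++ˢ-agreeOff : (xs : List Bool) {s t : Seq} →
               AgreeOff 0 s t → AgreeOff (length xs) (xs ++ˢ s) (xs ++ˢ t)
++ˢ-agreeOff [] s≈t m m≢0 = s≈t m m≢0
++ˢ-agreeOff (x ∷ xs) s≈t zero _ = refl
++ˢ-agreeOff (x ∷ xs) s≈t (suc m) m≢ = ++ˢ-agreeOff xs s≈t m (m≢ ∘ cong suc)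

thin-excludes-bitFlip : {F : Subset} → Thin F → {x y : Seq} (c : List Bool) (r : Seq) →
                        F x → F y → x ≗ c ++ˢ [ false ] ++ˢ r → y ≗ c ++ˢ [ true ] ++ˢ r → ⊥
thin-excludes-bitFlip thin {x} {y} c r Fx Fy x≗ y≗ = false≢true (begin
    false         ≡⟨ sym (trans (x≗ (length c)) (++ˢ-length c _)) ⟩
    x (length c)  ≡⟨ thin (length c) x y Fx Fy agree (length c) ⟩
    y (length c)  ≡⟨ trans (y≗ (length c)) (++ˢ-length c _) ⟩
    true          ∎)
  where
  open ≡-Reasoning

  false≢true : false ≢ true
  false≢true ()

  bitFlip-agreeOff : AgreeOff 0 ([ false ] ++ˢ r) ([ true ] ++ˢ r)
  bitFlip-agreeOff zero 0≢0 = ⊥-elim (0≢0 refl)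
  bitFlip-agreeOff (suc m) _ = refl

  agree : AgreeOff (length c) x y
  agree m m≢ = trans (x≗ m) (trans (++ˢ-agreeOff c bitFlip-agreeOff m m≢) (sym (y≗ m)))

≤⇒<length⁺+ : (v : Word) {k f : ℕ} → k ≤ f → k < length (toList v) + f
≤⇒<length⁺+ (b ∷ bs) {f = f} k≤f = s≤s (≤-trans k≤f (m≤n+m f (length bs)))

walk-cong : ∀ f xs {w w′ : ℕ → Word} → w ≗ w′ → walk f xs w ≗ walk f xs w′
walk-cong f (b ∷ bs) w≗ zero = refl
walk-cong f (b ∷ bs) w≗ (suc k) = walk-cong f bs w≗ k
walk-cong zero [] w≗ k = refl
walk-cong (suc f) [] {w} {w′} w≗ k =
  trans (cong (λ v → walk f (toList v) (w ∘ suc) k) (w≗ 0)) (walk-cong f (toList (w′ 0)) (w≗ ∘ suc) k)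

concatWords-cong : {w w′ : ℕ → Word} → w ≗ w′ → concatWords w ≗ concatWords w′
concatWords-cong w≗ k = walk-cong (suc k) [] w≗ k

-- Every opened word is nonempty, so any fuel beyond the position sought is enough.
walk-fuel : ∀ f g xs w k → k < length xs + f → k < length xs + g → walk f xs w k ≡ walk g xs w k
walk-fuel f g (b ∷ bs) w zero _ _ = refl
walk-fuel f g (b ∷ bs) w (suc k) (s≤s p) (s≤s q) = walk-fuel f g bs w k p q
walk-fuel zero g [] w k () q
walk-fuel (suc f) zero [] w k p ()
walk-fuel (suc f) (suc g) [] w k (s≤s p) (s≤s q) =
  walk-fuel f g (toList (w 0)) (w ∘ suc) k (≤⇒<length⁺+ (w 0) p) (≤⇒<length⁺+ (w 0) q)

walk-++ˢ : ∀ f xs w k → k < length xs + f → walk f xs w k ≡ (xs ++ˢ concatWords w) k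
walk-++ˢ f (b ∷ bs) w zero _ = refl
walk-++ˢ f (b ∷ bs) w (suc k) (s≤s p) = walk-++ˢ f bs w k p
walk-++ˢ (suc f) [] w k (s≤s p) =
  walk-fuel f k (toList (w 0)) (w ∘ suc) k (≤⇒<length⁺+ (w 0) p) (≤⇒<length⁺+ (w 0) ≤-refl)

concatWords-cons : (w : ℕ → Word) → concatWords w ≗ toList (w 0) ++ˢ concatWords (w ∘ suc)
concatWords-cons w k = walk-++ˢ k (toList (w 0)) (w ∘ suc) k (≤⇒<length⁺+ (w 0) ≤-refl)

concatWords-cons₂ : (w : ℕ → Word) →
                    concatWords w ≗ toList (w 0) ++ˢ toList (w 1) ++ˢ concatWords (w ∘ suc ∘ suc)
concatWords-cons₂ w k =
  trans (concatWords-cons w k) (++ˢ-cong (toList (w 0)) (concatWords-cons (w ∘ suc)) k)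

interleave-cong : {A : Set} {s s′ t t′ : ℕ → A} → s ≗ s′ → t ≗ t′ → interleave s t ≗ interleave s′ t′
interleave-cong s≗ t≗ zero = s≗ 0
interleave-cong s≗ t≗ (suc i) = interleave-cong t≗ (s≗ ∘ suc) i

length-⁺∷ʳ : {A : Set} (xs : List⁺ A) (x : A) → length⁺ (xs ⁺∷ʳ x) ≡ suc (length⁺ xs)
length-⁺∷ʳ (y ∷ ys) x = cong suc (trans (length-++ ys) (+-comm (length ys) 1))

length-egoHist : ∀ e a n → length⁺ (Play.egoHist e a n) ≡ suc n
length-egoHist e a zero = refl
length-egoHist e a (suc n) =
  trans (length-⁺∷ʳ (Play.egoHist e a n) _) (cong suc (length-egoHist e a n))

-- Ego's history is never empty, so α 0 is never played.
alterPlaying : (ℕ → Word) → AlterStrategy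
alterPlaying α h = α (length⁺ h)

module _ (e : EgoStrategy) (α : ℕ → Word) (hist : ℕ → List Word)
         (hist-zero : hist 0 ≡ [])
         (hist-suc : ∀ n → hist (suc n) ≡ hist n ++ [ α (suc n) ]) where

  alterHist-alterPlaying : ∀ n → Play.alterHist e (alterPlaying α) n ≡ hist n
  alterHist-alterPlaying zero = sym hist-zero
  alterHist-alterPlaying (suc n) =
    trans (cong₂ (λ h m → h ++ [ α m ]) (alterHist-alterPlaying n)
                 (length-egoHist e (alterPlaying α) n))
          (sym (hist-suc n))

  outcome-alterPlaying : outcome e (alterPlaying α) ≗ concatWords (interleave (e ∘ hist) (α ∘ suc))
  outcome-alterPlaying = concatWords-cong (interleave-cong
    (cong e ∘ alterHist-alterPlaying) (cong α ∘ length-egoHist e (alterPlaying α)))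

module Copycat (e : EgoStrategy) where
  mutual
    αᶠ αᵗ : ℕ → Word
    αᶠ zero = [ false ]⁺
    αᶠ (suc zero) = [ false ]⁺
    αᶠ (suc (suc n)) = e (histᵗ (suc n))
    αᵗ zero = [ true ]⁺
    αᵗ (suc zero) = true ∷ toList (e (histᶠ 1))
    αᵗ (suc (suc n)) = e (histᶠ (suc (suc n)))

    histᶠ histᵗ : ℕ → List Word
    histᶠ zero = []
    histᶠ (suc n) = histᶠ n ++ [ αᶠ (suc n) ]
    histᵗ zero = []
    histᵗ (suc n) = histᵗ n ++ [ αᵗ (suc n) ]

  εᶠ εᵗ : ℕ → Word
  εᶠ = e ∘ histᶠ
  εᵗ = e ∘ histᵗ

  crossMoves : ℕ → Word
  crossMoves = interleave (εᶠ ∘ suc) (εᵗ ∘ suc)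

  rest : Seq
  rest = concatWords crossMoves

  ε₀ : List Bool
  ε₀ = toList (e [])

  -- From the third word on, the two plays list crossMoves and crossMoves ∘ suc; both
  -- hold by unfolding interleave, since each copy's Alter move is the other's Ego move.
  outcomeᶠ : outcome e (alterPlaying αᶠ) ≗ ε₀ ++ˢ [ false ] ++ˢ rest
  outcomeᶠ k = trans (outcome-alterPlaying e αᶠ histᶠ refl (λ _ → refl) k)
                     (concatWords-cons₂ (interleave εᶠ (αᶠ ∘ suc)) k)

  outcomeᵗ : outcome e (alterPlaying αᵗ) ≗ ε₀ ++ˢ [ true ] ++ˢ rest
  outcomeᵗ k = begin
    outcome e (alterPlaying αᵗ) k
      ≡⟨ outcome-alterPlaying e αᵗ histᵗ refl (λ _ → refl) k ⟩
    concatWords (interleave εᵗ (αᵗ ∘ suc)) k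
      ≡⟨ concatWords-cons₂ (interleave εᵗ (αᵗ ∘ suc)) k ⟩
    (ε₀ ++ˢ (true ∷ toList (εᶠ 1)) ++ˢ concatWords (crossMoves ∘ suc)) k
      ≡⟨ ++ˢ-cong ε₀ (λ j → trans (++ˢ-assoc [ true ] _ _ j)
                                  (++ˢ-cong [ true ] (sym ∘ concatWords-cons crossMoves) j)) k ⟩
    (ε₀ ++ˢ [ true ] ++ˢ rest) k ∎
    where open ≡-Reasoning

mainTheorem3 : (F : Subset) → Thin F → ¬ ∃ (λ e → EgoWinning F e)
mainTheorem3 F thin (e , win) =
  thin-excludes-bitFlip thin ε₀ rest (win (alterPlaying αᶠ)) (win (alterPlaying αᵗ)) outcomeᶠ outcomeᵗ
  where open Copycat e
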